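{- Let $G=(V,E)$ be a finite simple undirected graph, and let $\mathcal{B}=\mathcal{A}\cup\mathcal{D}$ be a batch of edge updates, where $\mathcal{A}$ is a set of edges to add (pairs of distinct vertices of $V$ not in $E$) and $\mathcal{D}\subseteq E$ is a set of edges to delete. Let $G'=(V,(E\cup\mathcal{A})\setminus\mathcal{D})$ be the updated graph. Let $$H=\bigcup_{e=(u,v)\in\mathcal{A}\cup\mathcal{D}} G[N_3(u)\cup N_3(v)],$$ where $N_3(x)$ is the $3$-hop neighborhood of $x$ in $G$ and $G[S]$ is the subgraph of $G$ induced by $S$ (the union being taken over vertex sets and edge sets). Define $\mathcal{G}_a=(H\setminus\mathcal{D})\cup\mathcal{A}$ and $\mathcal{G}_b=(H\setminus\mathcal{A})\cup\mathcal{D}$ (removing, resp. adding, the indicated edges together with their endpoints as vertices). Let $\mathcal{C}_a$ and $\mathcal{C}_b$ be the graphlet frequency vectors of $\mathcal{G}_a$ and $\mathcal{G}_b$. Then $$\mathcal{F}^{G'}_4=\mathcal{F}^{G}_4+\mathcal{C}_a-\mathcal{C}_b,$$ i.e., the Fully Dynamic Graphlet Counting update (replacing the global frequency vector $\mathcal{F}^{G}_4$ by $\mathcal{F}^{G}_4+\mathcal{C}_a-\mathcal{C}_b$) correctly yields the graphlet frequency vector of the updated graph.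
   Context: A graphlet of size $4$ is a connected induced subgraph on $4$ vertices. Up to isomorphism there are six connected graphs on $4$ vertices: the $3$-path, the $3$-star, the $4$-cycle, the tailed triangle (a triangle with a pendant edge), the diamond ($K_4$ minus an edge), and the $4$-clique. For a graph $X$, its graphlet frequency vector $\mathcal{F}^X_4\in\mathbb{Z}_{\ge0}^6$ has, for each of these six types $T$, the number of $4$-element vertex subsets $S$ of $X$ such that the induced subgraph $X[S]$ is isomorphic to $T$. The $k$-hop neighborhood $N_k(x)$ of a vertex $x$ in a graph is the set of vertices at distance at most $k$ from $x$ in that graph. -}

module Defs where

open import Data.Bool using (Bool; true; false; _∧_; _∨_; not; if_then_else_)
open import Data.Nat using (ℕ; zero; suc) renaming (_<ᵇ_ to _<ℕᵇ_)
open import Data.Fin using (Fin; toℕ) renaming (zero to f0; suc to fs)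
open import Data.Fin.Properties using (_≟_)
open import Data.List using (List; []; _∷_; length; concatMap; filterᵇ; allFin)
import Data.List as L
open import Data.Bool.ListAction using (any; all)
open import Data.Product using (_×_; _,_)
open import Relation.Nullary.Decidable using (⌊_⌋)
open import Relation.Binary.PropositionalEquality using (_≡_; _≢_)

anyFin : ∀ {n} → (Fin n → Bool) → Bool
anyFin {n} f = any f (allFin n)

allFinᵇ : ∀ {n} → (Fin n → Bool) → Bool
allFinᵇ {n} f = all f (allFin n)

_==_ : ∀ {n} → Fin n → Fin n → Bool
x == y = ⌊ x ≟ y ⌋

_<ᵇ_ : ∀ {n} → Fin n → Fin n → Bool
x <ᵇ y = toℕ x <ℕᵇ toℕ y

record Graph (n : ℕ) : Set where
  field
    adj    : Fin n → Fin n → Bool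
    sym    : ∀ x y → adj x y ≡ adj y x
    irrefl : ∀ x → adj x x ≡ false
open Graph public

record SGraph (n : ℕ) : Set where
  field
    vert : Fin n → Bool
    edge : Fin n → Fin n → Bool
open SGraph public

toSGraph : ∀ {n} → Graph n → SGraph n
toSGraph G = record { vert = λ _ → true ; edge = adj G }

v0 v1 v2 v3 : Fin 4
v0 = f0
v1 = fs f0
v2 = fs (fs f0)
v3 = fs (fs (fs f0))

edgesToAdj : List (Fin 4 × Fin 4) → Fin 4 → Fin 4 → Bool
edgesToAdj [] i j = false
edgesToAdj ((a , b) ∷ es) i j =
  ((a == i) ∧ (b == j)) ∨ ((a == j) ∧ (b == i)) ∨ edgesToAdj es i j

path3 star3 cycle4 tailedTriangle diamond clique4 : Fin 4 → Fin 4 → Bool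
path3 = edgesToAdj ((v0 , v1) ∷ (v1 , v2) ∷ (v2 , v3) ∷ [])
star3 = edgesToAdj ((v0 , v1) ∷ (v0 , v2) ∷ (v0 , v3) ∷ [])
cycle4 = edgesToAdj ((v0 , v1) ∷ (v1 , v2) ∷ (v2 , v3) ∷ (v3 , v0) ∷ [])
tailedTriangle = edgesToAdj ((v0 , v1) ∷ (v1 , v2) ∷ (v2 , v0) ∷ (v2 , v3) ∷ [])
diamond = edgesToAdj ((v0 , v1) ∷ (v0 , v2) ∷ (v1 , v2) ∷ (v1 , v3) ∷ (v2 , v3) ∷ [])
clique4 = edgesToAdj ((v0 , v1) ∷ (v0 , v2) ∷ (v0 , v3) ∷ (v1 , v2) ∷ (v1 , v3) ∷ (v2 , v3) ∷ [])

graphlet : Fin 6 → Fin 4 → Fin 4 → Bool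
graphlet f0 = path3
graphlet (fs f0) = star3
graphlet (fs (fs f0)) = cycle4
graphlet (fs (fs (fs f0))) = tailedTriangle
graphlet (fs (fs (fs (fs f0)))) = diamond
graphlet (fs (fs (fs (fs (fs f0))))) = clique4

-- 4-element vertex subsets, represented as strictly increasing 4-tuples.

Quad : ℕ → Set
Quad n = Fin n × Fin n × Fin n × Fin n

quadAt : ∀ {n} → Quad n → Fin 4 → Fin n
quadAt (a , b , c , d) f0 = a
quadAt (a , b , c , d) (fs f0) = b
quadAt (a , b , c , d) (fs (fs f0)) = c
quadAt (a , b , c , d) (fs (fs (fs f0))) = d

allQuads : ∀ n → List (Quad n)
allQuads n =
  concatMap (λ a → concatMap (λ b → concatMap (λ c → L.map (λ d → (a , b , c , d))
    (filterᵇ (c <ᵇ_) (allFin n))) (filterᵇ (b <ᵇ_) (allFin n))) (filterᵇ (a <ᵇ_) (allFin n)))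
    (allFin n)

-- Induced subgraph X[S] (S = the 4 vertices of q) is isomorphic to T:
-- there is a bijection σ : Fin 4 → Fin 4 (given by its four values) such that
-- template vertex i ↦ quadAt q (σ i) preserves and reflects adjacency.
isoᵇ : ∀ {n} → SGraph n → Quad n → (Fin 4 → Fin 4 → Bool) → Bool
isoᵇ X q T =
  anyFin λ s0 → anyFin λ s1 → anyFin λ s2 → anyFin λ s3 →
    let σ : Fin 4 → Fin 4
        σ = λ { f0 → s0 ; (fs f0) → s1 ; (fs (fs f0)) → s2 ; (fs (fs (fs f0))) → s3 }
    in (allFinᵇ λ i → allFinᵇ λ j → (i == j) ∨ not (σ i == σ j))
       ∧ (allFinᵇ λ i → allFinᵇ λ j →
            (edge X (quadAt q (σ i)) (quadAt q (σ j))) ∧ T i j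
            ∨ not (edge X (quadAt q (σ i)) (quadAt q (σ j))) ∧ not (T i j))

inVerts : ∀ {n} → SGraph n → Quad n → Bool
inVerts X q = allFinᵇ λ i → vert X (quadAt q i)

freq : ∀ {n} → SGraph n → Fin 6 → ℕ
freq {n} X t = length (filterᵇ (λ q → inVerts X q ∧ isoᵇ X q (graphlet t)) (allQuads n))

withinᵇ : ∀ {n} → Graph n → ℕ → Fin n → Fin n → Bool
withinᵇ G zero x y = x == y
withinᵇ G (suc k) x y = withinᵇ G k x y ∨ anyFin (λ z → withinᵇ G k x z ∧ adj G z y)

N3 : ∀ {n} → Graph n → Fin n → Fin n → Bool
N3 G x y = withinᵇ G 3 x y

-- Edge sets A, D given as symmetric Boolean relations on Fin n.
-- updated graph G' = (V, (E ∪ A) \ D)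
updated : ∀ {n} → Graph n → (A D : Fin n → Fin n → Bool) → SGraph n
updated G A D = record { vert = λ _ → true
                       ; edge = λ x y → (adj G x y ∨ A x y) ∧ not (D x y) }

Sₑ : ∀ {n} → Graph n → Fin n → Fin n → Fin n → Bool
Sₑ G u v x = N3 G u x ∨ N3 G v x

Hgraph : ∀ {n} → Graph n → (A D : Fin n → Fin n → Bool) → SGraph n
Hgraph G A D = record
  { vert = λ x → anyFin λ u → anyFin λ v → (A u v ∨ D u v) ∧ Sₑ G u v x
  ; edge = λ x y → anyFin λ u → anyFin λ v →
             (A u v ∨ D u v) ∧ Sₑ G u v x ∧ Sₑ G u v y ∧ adj G x y }

endpoint : ∀ {n} → (Fin n → Fin n → Bool) → Fin n → Bool
endpoint R x = anyFin λ y → R x y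

Ga : ∀ {n} → Graph n → (A D : Fin n → Fin n → Bool) → SGraph n
Ga G A D = record
  { vert = λ x → vert (Hgraph G A D) x ∨ endpoint A x
  ; edge = λ x y → (edge (Hgraph G A D) x y ∧ not (D x y)) ∨ A x y }

Gb : ∀ {n} → Graph n → (A D : Fin n → Fin n → Bool) → SGraph n
Gb G A D = record
  { vert = λ x → vert (Hgraph G A D) x ∨ endpoint D x
  ; edge = λ x y → (edge (Hgraph G A D) x y ∧ not (A x y)) ∨ D x y }

-- Fix a 4-set S of vertices. If no batch pair lies in S, then G′ agrees with G
-- and 𝒢_a with 𝒢_b on S. Otherwise, if S induces a graphlet in one of the four
-- graphs, it induces a connected graph with edges in G ∪ 𝒜 ∪ 𝒟, and connectivity
-- places every vertex and every G-edge of S within distance 2 of some batch pair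
-- (u, v), i.e. inside N₃(u) ∪ N₃(v). Then S ⊆ V(H) and H agrees with G on S, so
-- 𝒢_a agrees with G′ and 𝒢_b with G on S. Either way S contributes equally to
-- F^{G′} + C_b and to F^G + C_a; summing over S gives the formula.

module Submission where

open import Defs hiding (sym)
open import Algebra.Properties.CommutativeSemigroup using (interchange)
open import Data.Bool using (Bool; true; false; T; _∧_; _∨_; not)
open import Data.Bool.ListAction using (and)
open import Data.Bool.Properties using (T-≡; T-∧; T-∨; T-not-≡)
open import Data.Empty using (⊥-elim)
open import Data.Fin using (Fin; punchOut)
open import Data.Fin.Properties using (_≟_; any?; all?; punchOut-injective; injective⇒≤)
open import Data.Integer using (+_; _+_; _-_; _⊖_)
open import Data.Integer.Properties using (pos-+; [+m]-[+n]≡m⊖n; +-cancelˡ-⊖)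
open import Data.List using (List; []; _∷_; length; filterᵇ; allFin)
open import Data.List.Membership.Propositional using (lose)
open import Data.List.Membership.Propositional.Properties using (∈-allFin)
open import Data.List.Properties using (map-cong)
open import Data.List.Relation.Unary.All as All using ()
open import Data.List.Relation.Unary.All.Properties using (all⁺; all⁻)
open import Data.List.Relation.Unary.Any using (satisfied)
open import Data.List.Relation.Unary.Any.Properties using (any⁺; any⁻)
open import Data.Nat using (ℕ; zero; suc)
import Data.Nat as ℕ
open import Data.Nat.Properties using (+-comm; +-identityʳ; +-commutativeSemigroup; n≮n)
open import Data.Product using (_×_; _,_; proj₁; proj₂; ∃; ∃₂; ∃-syntax; uncurry)
open import Data.Sum using (_⊎_; inj₁; inj₂)
import Data.Sum as Sum
open import Data.Unit using (tt)
open import Data.Vec using ([]; _∷_; tabulate; lookup)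
open import Data.Vec.Properties using (tabulate-cong)
open import Function using (_∘_)
open import Function.Bundles using (module Equivalence)
open import Function.Definitions using (Injective)
open import Relation.Binary.PropositionalEquality
  using (_≡_; _≢_; refl; sym; trans; cong; cong₂; subst; module ≡-Reasoning)
open import Relation.Nullary using (¬_; Dec; yes; no; contradiction)
open import Relation.Nullary.Decidable
  using (map′; ¬?; _×-dec_; _⊎-dec_; _→-dec_; T?; toWitness; fromWitness)

open Equivalence using (to; from)

T-⇔⇒≡ : ∀ {x y} → (T x → T y) → (T y → T x) → x ≡ y
T-⇔⇒≡ {true}  {true}  _ _ = refl
T-⇔⇒≡ {true}  {false} x⇒y _ = ⊥-elim (x⇒y _)
T-⇔⇒≡ {false} {true}  _ y⇒x = ⊥-elim (y⇒x _)
T-⇔⇒≡ {false} {false} _ _ = refl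

≡-from-either-true : ∀ {x y} {P : Set} → (T x → P) → (T y → P) → (P → x ≡ y) → x ≡ y
≡-from-either-true {true}  x⇒P _ P⇒≡ = P⇒≡ (x⇒P _)
≡-from-either-true {false} {true} _ y⇒P P⇒≡ = P⇒≡ (y⇒P _)
≡-from-either-true {false} {false} _ _ _ = refl

∨-redundantʳ : ∀ {x y} → (T y → T x) → x ∨ y ≡ x
∨-redundantʳ {true} _ = refl
∨-redundantʳ {false} {true} y⇒x = ⊥-elim (y⇒x _)
∨-redundantʳ {false} {false} _ = refl

xnor⇒T : ∀ x y → T (x ∧ y ∨ not x ∧ not y) → T y → T x
xnor⇒T true  _     _  _ = tt
xnor⇒T false true  () _
xnor⇒T false false _  ()

anyFin⁺ : ∀ {n} {f : Fin n → Bool} x → T (f x) → T (anyFin f)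
anyFin⁺ {f = f} x fx = any⁺ f (lose (∈-allFin x) fx)

anyFin⁻ : ∀ {n} {f : Fin n → Bool} → T (anyFin f) → ∃ λ x → T (f x)
anyFin⁻ {n} {f} p = satisfied (any⁻ f (allFin n) p)

allFinᵇ⁺ : ∀ {n} {f : Fin n → Bool} → (∀ x → T (f x)) → T (allFinᵇ f)
allFinᵇ⁺ {n} {f} h = all⁻ f {xs = allFin n} (All.tabulate λ {x} _ → h x)

allFinᵇ⁻ : ∀ {n} {f : Fin n → Bool} → T (allFinᵇ f) → ∀ x → T (f x)
allFinᵇ⁻ {n} {f} p x = All.lookup (all⁺ f (allFin n) p) (∈-allFin x)

allFinᵇ²⁻ : ∀ {n} (f : Fin n → Fin n → Bool) → T (allFinᵇ λ x → allFinᵇ (f x)) → ∀ x y → T (f x y)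
allFinᵇ²⁻ f p x = allFinᵇ⁻ {f = f x} (allFinᵇ⁻ {f = λ x → allFinᵇ (f x)} p x)

allFinᵇ-cong : ∀ {n} {f g : Fin n → Bool} → (∀ x → f x ≡ g x) → allFinᵇ f ≡ allFinᵇ g
allFinᵇ-cong {n} f≗g = cong and (map-cong f≗g (allFin n))

injective⇒surjective : ∀ {n} {f : Fin n → Fin n} → Injective _≡_ _≡_ f → ∀ y → ∃ λ x → f x ≡ y
injective⇒surjective {suc n} {f} f-injective y with any? (λ x → f x ≟ y)
... | yes hit = hit
... | no miss = contradiction (injective⇒≤ g-injective) (n≮n n)
  where
  g : Fin (suc n) → Fin n
  g x = punchOut {i = y} {j = f x} λ y≡fx → miss (x , sym y≡fx)
  g-injective : Injective _≡_ _≡_ g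
  g-injective = f-injective ∘ punchOut-injective {i = y} _ _

-- Connected graphs on four vertices

Distinct : ∀ {A : Set} → A → A → A → A → Set
Distinct i j k l = i ≢ j × i ≢ k × i ≢ l × j ≢ k × j ≢ l × k ≢ l

distinct? : (i j k l : Fin 4) → Dec (Distinct i j k l)
distinct? i j k l =
  ¬? (i ≟ j) ×-dec ¬? (i ≟ k) ×-dec ¬? (i ≟ l) ×-dec ¬? (j ≟ k) ×-dec ¬? (j ≟ l) ×-dec ¬? (k ≟ l)

distinct-unmap : ∀ {A B : Set} (f : A → B) {i j k l} → Distinct (f i) (f j) (f k) (f l) → Distinct i j k l
distinct-unmap f (ij , ik , il , jk , jl , kl) =
  ij ∘ cong f , ik ∘ cong f , il ∘ cong f , jk ∘ cong f , jl ∘ cong f , kl ∘ cong f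

Across : (Fin 4 → Fin 4 → Bool) → (i j k l : Fin 4) → Set
Across E i j k l = T (E i k) ⊎ T (E i l) ⊎ T (E j k) ⊎ T (E j l)

across? : ∀ E (i j k l : Fin 4) → Dec (Across E i j k l)
across? E i j k l = T? (E i k) ⊎-dec T? (E i l) ⊎-dec T? (E j k) ⊎-dec T? (E j l)

-- On four vertices a graph is connected iff no vertex is isolated and no
-- splitting of the vertices into two pairs leaves the pairs unjoined.
record Connected₄ (E : Fin 4 → Fin 4 → Bool) : Set where
  constructor connected₄
  field
    neighbour : ∀ i → ∃[ j ] T (E i j)
    across    : ∀ i j k l → Distinct i j k l → Across E i j k l
open Connected₄

connected₄? : ∀ E → Dec (Connected₄ E)
connected₄? E = map′ (uncurry connected₄) (λ c → neighbour c , across c)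
  ((all? λ i → any? λ j → T? (E i j)) ×-dec
   (all? λ i → all? λ j → all? λ k → all? λ l → distinct? i j k l →-dec across? E i j k l))

graphlet-connected : ∀ t → Connected₄ (graphlet t)
graphlet-connected = toWitness {a? = all? λ t → connected₄? (graphlet t)} _

connected₄-image : ∀ {E F} {σ : Fin 4 → Fin 4} → (∀ y → ∃ λ x → σ x ≡ y) →
  (∀ i j → T (F i j) → T (E (σ i) (σ j))) → Connected₄ F → Connected₄ E
connected₄-image {E} {F} {σ} σ-surjective hom F-connected = connected₄ neighbourᴱ acrossᴱ
  where
  neighbourᴱ : ∀ a → ∃[ b ] T (E a b)
  neighbourᴱ a with σ-surjective a
  ... | i , refl = let j , Fij = neighbour F-connected i in σ j , hom i j Fij
  acrossᴱ : ∀ a b c d → Distinct a b c d → Across E a b c d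
  acrossᴱ a b c d abcd with σ-surjective a | σ-surjective b | σ-surjective c | σ-surjective d
  ... | i , refl | j , refl | k , refl | l , refl =
    Sum.map (hom i k) (Sum.map (hom i l) (Sum.map (hom j k) (hom j l)))
      (across F-connected i j k l (distinct-unmap σ abcd))

connected₄-mono : ∀ {E F} → (∀ i j → T (F i j) → T (E i j)) → Connected₄ F → Connected₄ E
connected₄-mono = connected₄-image (λ y → y , refl)

record Monomorphism₄ (F E : Fin 4 → Fin 4 → Bool) : Set where
  field
    map       : Fin 4 → Fin 4
    injective : Injective _≡_ _≡_ map
    preserves : ∀ i j → T (F i j) → T (E (map i) (map j))

monomorphism₄-connected : ∀ {E F} → Monomorphism₄ F E → Connected₄ F → Connected₄ E
monomorphism₄-connected σ = connected₄-image (injective⇒surjective (injective σ)) (preserves σ)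
  where open Monomorphism₄

-- Graphlet occurrences

induced : ∀ {n} → (Fin n → Fin n → Bool) → Quad n → Fin 4 → Fin 4 → Bool
induced R q i j = R (quadAt q i) (quadAt q j)

injectiveᵇ : (Fin 4 → Fin 4) → Bool
injectiveᵇ σ = allFinᵇ λ i → allFinᵇ λ j → (i == j) ∨ not (σ i == σ j)

matchesᵇ : (E F : Fin 4 → Fin 4 → Bool) → (Fin 4 → Fin 4) → Bool
matchesᵇ E F σ = allFinᵇ λ i → allFinᵇ λ j → E (σ i) (σ j) ∧ F i j ∨ not (E (σ i) (σ j)) ∧ not (F i j)

isIsoᵇ : (E F : Fin 4 → Fin 4 → Bool) → (Fin 4 → Fin 4) → Bool
isIsoᵇ E F σ = injectiveᵇ σ ∧ matchesᵇ E F σ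

isoOn : (E F : Fin 4 → Fin 4 → Bool) → Bool
isoOn E F = anyFin λ a → anyFin λ b → anyFin λ c → anyFin λ d → isIsoᵇ E F (lookup (a ∷ b ∷ c ∷ d ∷ []))

isoᵇ≡isoOn : ∀ {n} (X : SGraph n) q F → isoᵇ X q F ≡ isoOn (induced (edge X) q) F
isoᵇ≡isoOn X q F = refl

-- isoOn evaluates E only at the sixteen concrete pairs, so it factors
-- definitionally through the 4 × 4 table tabulating E.
isoOn-cong : ∀ {E E′} F → (∀ i j → E i j ≡ E′ i j) → isoOn E F ≡ isoOn E′ F
isoOn-cong F E≗E′ = cong (λ t → isoOn (λ i j → lookup (lookup t i) j) F)
  (tabulate-cong λ i → tabulate-cong (E≗E′ i))

isIsoᵇ-monomorphism₄ : ∀ {E F σ} → T (isIsoᵇ E F σ) → Monomorphism₄ F E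
isIsoᵇ-monomorphism₄ {E} {F} {σ} iso = record { map = σ ; injective = injective ; preserves = preserves }
  where
  injective : Injective _≡_ _≡_ σ
  injective {i} {j} σi≡σj
    with T-∨ {i == j} {not (σ i == σ j)} .to (allFinᵇ²⁻ (λ i j → (i == j) ∨ not (σ i == σ j))
                    (proj₁ (T-∧ {injectiveᵇ σ} {matchesᵇ E F σ} .to iso)) i j)
  ... | inj₁ i≡j = toWitness {a? = i ≟ j} i≡j
  ... | inj₂ σi≢σj = ⊥-elim (subst T (T-not-≡ .to σi≢σj) (fromWitness {a? = σ i ≟ σ j} σi≡σj))
  preserves : ∀ i j → T (F i j) → T (E (σ i) (σ j))
  preserves i j = xnor⇒T (E (σ i) (σ j)) (F i j)
    (allFinᵇ²⁻ (λ i j → E (σ i) (σ j) ∧ F i j ∨ not (E (σ i) (σ j)) ∧ not (F i j))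
      (proj₂ (T-∧ {injectiveᵇ σ} {matchesᵇ E F σ} .to iso)) i j)

isoOn-monomorphism₄ : ∀ {E F} → T (isoOn E F) → Monomorphism₄ F E
isoOn-monomorphism₄ {E} {F} iso =
  let a , iso₁ = anyFin⁻ {f = λ a → anyFin λ b → anyFin λ c → anyFin λ d → isIsoᵇ E F (lookup (a ∷ b ∷ c ∷ d ∷ []))} iso
      b , iso₂ = anyFin⁻ {f = λ b → anyFin λ c → anyFin λ d → isIsoᵇ E F (lookup (a ∷ b ∷ c ∷ d ∷ []))} iso₁
      c , iso₃ = anyFin⁻ {f = λ c → anyFin λ d → isIsoᵇ E F (lookup (a ∷ b ∷ c ∷ d ∷ []))} iso₂
      d , iso₄ = anyFin⁻ {f = λ d → isIsoᵇ E F (lookup (a ∷ b ∷ c ∷ d ∷ []))} iso₃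
  in isIsoᵇ-monomorphism₄ {E} {F} {lookup (a ∷ b ∷ c ∷ d ∷ [])} iso₄

isoᵇ-cong : ∀ {n} (X Y : SGraph n) q F → (∀ i j → induced (edge X) q i j ≡ induced (edge Y) q i j) →
  isoᵇ X q F ≡ isoᵇ Y q F
isoᵇ-cong X Y q F X≗Y =
  trans (isoᵇ≡isoOn X q F) (trans (isoOn-cong F X≗Y) (sym (isoᵇ≡isoOn Y q F)))

occurs : ∀ {n} → SGraph n → Fin 6 → Quad n → Bool
occurs X t q = inVerts X q ∧ isoᵇ X q (graphlet t)

occurs-connected : ∀ {n} (X : SGraph n) t q → T (occurs X t q) → Connected₄ (induced (edge X) q)
occurs-connected X t q o = monomorphism₄-connected
  (isoOn-monomorphism₄ {induced (edge X) q} {graphlet t}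
    (subst T (isoᵇ≡isoOn X q (graphlet t)) (proj₂ (T-∧ {inVerts X q} .to o))))
  (graphlet-connected t)

-- Counting

indicator : Bool → ℕ
indicator true  = 1
indicator false = 0

SamePair : ∀ {A : Set} → A → A → A → A → Set
SamePair a b c d = (a ≡ c × b ≡ d) ⊎ (a ≡ d × b ≡ c)

indicator-samePair : ∀ {a b c d} → SamePair a b c d →
  indicator a ℕ.+ indicator b ≡ indicator c ℕ.+ indicator d
indicator-samePair (inj₁ (refl , refl)) = refl
indicator-samePair {a} {b} (inj₂ (refl , refl)) = +-comm (indicator a) (indicator b)

length-filterᵇ-∷ : ∀ {A : Set} (p : A → Bool) x xs →
  length (filterᵇ p (x ∷ xs)) ≡ indicator (p x) ℕ.+ length (filterᵇ p xs)
length-filterᵇ-∷ p x xs with p x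
... | true  = refl
... | false = refl

length-filterᵇ-samePair : ∀ {A : Set} {p s r u : A → Bool} →
  (∀ x → SamePair (p x) (s x) (r x) (u x)) → ∀ xs →
  length (filterᵇ p xs) ℕ.+ length (filterᵇ s xs) ≡ length (filterᵇ r xs) ℕ.+ length (filterᵇ u xs)
length-filterᵇ-samePair same [] = refl
length-filterᵇ-samePair {p = p} {s} {r} {u} same (x ∷ xs) = begin
  #p (x ∷ xs) ℕ.+ #s (x ∷ xs)
    ≡⟨ cong₂ ℕ._+_ (length-filterᵇ-∷ p x xs) (length-filterᵇ-∷ s x xs) ⟩
  (indicator (p x) ℕ.+ #p xs) ℕ.+ (indicator (s x) ℕ.+ #s xs)
    ≡⟨ interchange +-commutativeSemigroup (indicator (p x)) (#p xs) (indicator (s x)) (#s xs) ⟩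
  (indicator (p x) ℕ.+ indicator (s x)) ℕ.+ (#p xs ℕ.+ #s xs)
    ≡⟨ cong₂ ℕ._+_ (indicator-samePair (same x)) (length-filterᵇ-samePair same xs) ⟩
  (indicator (r x) ℕ.+ indicator (u x)) ℕ.+ (#r xs ℕ.+ #u xs)
    ≡⟨ interchange +-commutativeSemigroup (indicator (r x)) (indicator (u x)) (#r xs) (#u xs) ⟩
  (indicator (r x) ℕ.+ #r xs) ℕ.+ (indicator (u x) ℕ.+ #u xs)
    ≡⟨ sym (cong₂ ℕ._+_ (length-filterᵇ-∷ r x xs) (length-filterᵇ-∷ u x xs)) ⟩
  #r (x ∷ xs) ℕ.+ #u (x ∷ xs) ∎
  where
  open ≡-Reasoning
  #p #s #r #u : List _ → ℕ
  #p = length ∘ filterᵇ p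
  #s = length ∘ filterᵇ s
  #r = length ∘ filterᵇ r
  #u = length ∘ filterᵇ u

pos-≡-difference : ∀ a b c d → a ℕ.+ d ≡ b ℕ.+ c → + a ≡ (+ b + + c) - + d
pos-≡-difference a b c d a+d≡b+c = sym (begin
  (+ b + + c) - + d      ≡⟨ cong (_- + d) (sym (pos-+ b c)) ⟩
  + (b ℕ.+ c) - + d      ≡⟨ [+m]-[+n]≡m⊖n (b ℕ.+ c) d ⟩
  (b ℕ.+ c) ⊖ d          ≡⟨ cong₂ _⊖_ (trans (sym a+d≡b+c) (+-comm a d)) (sym (+-identityʳ d)) ⟩
  (d ℕ.+ a) ⊖ (d ℕ.+ 0)  ≡⟨ +-cancelˡ-⊖ d a 0 ⟩
  + a                    ∎)
  where open ≡-Reasoning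

module _ {n} (G : Graph n) where

  within-refl : ∀ k x → T (withinᵇ G k x x)
  within-refl zero    x = fromWitness refl
  within-refl (suc k) x = T-∨ .from (inj₁ (within-refl k x))

  within-step : ∀ {k x y z} → T (withinᵇ G k x y) → T (adj G y z) → T (withinᵇ G (suc k) x z)
  within-step {y = y} w a = T-∨ .from (inj₂ (anyFin⁺ y (T-∧ .from (w , a))))

  within-weaken : ∀ j {k x y} → T (withinᵇ G k x y) → T (withinᵇ G (j ℕ.+ k) x y)
  within-weaken zero    w = w
  within-weaken (suc j) w = T-∨ .from (inj₁ (within-weaken j w))

  N3-refl : ∀ x → T (N3 G x x)
  N3-refl = within-refl 3

  N3-adj : ∀ {x y} → T (adj G x y) → T (N3 G x y)
  N3-adj {x} {y} a = within-weaken 2 {1} {x} {y} (within-step {0} {x} (within-refl 0 x) a)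

  N3-path : ∀ {x y z} → T (adj G x y) → T (adj G y z) → T (N3 G x z)
  N3-path {x} {y} {z} a b = within-weaken 1 {2} {x} {z}
    (within-step {1} {x} (within-step {0} {x} (within-refl 0 x) a) b)

-- The batch update

module BatchUpdate {n} (G : Graph n) (A D : Fin n → Fin n → Bool)
  (A-sym : ∀ x y → A x y ≡ A y x) (D-sym : ∀ x y → D x y ≡ D y x)
  (A-new : ∀ x y → A x y ≡ true → x ≢ y × adj G x y ≡ false)
  (D-old : ∀ x y → D x y ≡ true → adj G x y ≡ true) where

  H G′ Gᵃ Gᵇ G₀ : SGraph n
  H  = Hgraph G A D
  G′ = updated G A D
  Gᵃ = Ga G A D
  Gᵇ = Gb G A D
  G₀ = toSGraph G

  B U : Fin n → Fin n → Bool
  B x y = A x y ∨ D x y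
  U x y = adj G x y ∨ B x y

  adj-sym : ∀ {x y} → T (adj G x y) → T (adj G y x)
  adj-sym {x} {y} = subst T (Graph.sym G x y)

  adj-irrefl : ∀ x → ¬ T (adj G x x)
  adj-irrefl x = subst T (irrefl G x)

  A⇒¬adj : ∀ {x y} → T (A x y) → ¬ T (adj G x y)
  A⇒¬adj {x} {y} a = subst T (proj₂ (A-new x y (T-≡ {A x y} .to a)))

  D⇒adj : ∀ {x y} → T (D x y) → T (adj G x y)
  D⇒adj {x} {y} d = T-≡ {adj G x y} .from (D-old x y (T-≡ {D x y} .to d))

  B-sym : ∀ {x y} → T (B x y) → T (B y x)
  B-sym {x} {y} = subst T (cong₂ _∨_ (A-sym x y) (D-sym x y))

  B-irrefl : ∀ x → ¬ T (B x x)
  B-irrefl x b with T-∨ {A x x} {D x x} .to b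
  ... | inj₁ a = proj₁ (A-new x x (T-≡ {A x x} .to a)) refl
  ... | inj₂ d = adj-irrefl x (D⇒adj d)

  Incident : Fin n → Set
  Incident x = ∃ λ w → T (B x w)

  incident? : ∀ x → Dec (Incident x)
  incident? x = any? λ w → T? (B x w)

  ¬incident-U⇒adj : ∀ {x y} → ¬ Incident x → T (U x y) → T (adj G x y)
  ¬incident-U⇒adj {x} {y} ¬x u with T-∨ {adj G x y} {B x y} .to u
  ... | inj₁ a = a
  ... | inj₂ b = ⊥-elim (¬x (y , b))

  InSameSₑ : Fin n → Fin n → Set
  InSameSₑ x y = ∃₂ λ u v → T (B u v) × T (Sₑ G u v x) × T (Sₑ G u v y)

  inSameSₑ-sym : ∀ {x y} → InSameSₑ x y → InSameSₑ y x
  inSameSₑ-sym (u , v , b , x∈S , y∈S) = u , v , b , y∈S , x∈S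

  near-u : ∀ {u v x} → T (N3 G u x) → T (Sₑ G u v x)
  near-u {u} {v} {x} = T-∨ {N3 G u x} {N3 G v x} .from ∘ inj₁

  inSameSₑ-at-batch : ∀ {x w y} → T (B x w) → T (adj G x y) → InSameSₑ x y
  inSameSₑ-at-batch {x} {w} b xy = x , w , b , near-u (N3-refl G x) , near-u (N3-adj G xy)

  inSameSₑ-near-batch : ∀ {u v x y} → T (B u v) → T (adj G u x) → T (adj G x y) → InSameSₑ x y
  inSameSₑ-near-batch {u} {v} b ux xy = u , v , b , near-u (N3-adj G ux) , near-u (N3-path G ux xy)

  inSameSₑ⇒vert-H : ∀ {x y} → InSameSₑ x y → T (vert H x)
  inSameSₑ⇒vert-H {x} (u , v , b , x∈S , _) =
    anyFin⁺ {f = λ u → anyFin λ v → B u v ∧ Sₑ G u v x} u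
      (anyFin⁺ {f = λ v → B u v ∧ Sₑ G u v x} v (T-∧ {B u v} .from (b , x∈S)))

  inSameSₑ⇒edge-H : ∀ {x y} → InSameSₑ x y → T (adj G x y) → T (edge H x y)
  inSameSₑ⇒edge-H {x} {y} (u , v , b , x∈S , y∈S) xy =
    anyFin⁺ {f = λ u → anyFin λ v → B u v ∧ Sₑ G u v x ∧ Sₑ G u v y ∧ adj G x y} u
      (anyFin⁺ {f = λ v → B u v ∧ Sₑ G u v x ∧ Sₑ G u v y ∧ adj G x y} v
        (T-∧ {B u v} .from (b , T-∧ {Sₑ G u v x} .from (x∈S , T-∧ {Sₑ G u v y} .from (y∈S , xy)))))

  edge-H⇒adj : ∀ {x y} → T (edge H x y) → T (adj G x y)
  edge-H⇒adj {x} {y} e =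
    let u , e₁ = anyFin⁻ {f = λ u → anyFin λ v → B u v ∧ Sₑ G u v x ∧ Sₑ G u v y ∧ adj G x y} e
        v , e₂ = anyFin⁻ {f = λ v → B u v ∧ Sₑ G u v x ∧ Sₑ G u v y ∧ adj G x y} e₁
    in proj₂ (T-∧ {Sₑ G u v y} .to (proj₂ (T-∧ {Sₑ G u v x} .to (proj₂ (T-∧ {B u v} .to e₂)))))

  B⇒vert-H : ∀ {x y} → T (B x y) → T (vert H x)
  B⇒vert-H {x} {y} b = inSameSₑ⇒vert-H {x} {x} (x , y , b , near-u (N3-refl G x) , near-u (N3-refl G x))

  vert-Gᵃ : ∀ x → vert Gᵃ x ≡ vert H x
  vert-Gᵃ x = ∨-redundantʳ λ e →
    let y , a = anyFin⁻ {f = A x} e in B⇒vert-H (T-∨ {A x y} {D x y} .from (inj₁ a))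

  vert-Gᵇ : ∀ x → vert Gᵇ x ≡ vert H x
  vert-Gᵇ x = ∨-redundantʳ λ e →
    let y , d = anyFin⁻ {f = D x} e in B⇒vert-H (T-∨ {A x y} {D x y} .from (inj₂ d))

  G′⊆U : ∀ x y → T (edge G′ x y) → T (U x y)
  G′⊆U x y = pointwise (adj G x y) (A x y) (D x y)
    where
    pointwise : ∀ g a d → T ((g ∨ a) ∧ not d) → T (g ∨ (a ∨ d))
    pointwise true  _     _ _ = tt
    pointwise false true  _ _ = tt
    pointwise false false _ ()

  G₀⊆U : ∀ x y → T (edge G₀ x y) → T (U x y)
  G₀⊆U x y = T-∨ {adj G x y} {B x y} .from ∘ inj₁

  Gᵃ⊆U : ∀ x y → T (edge Gᵃ x y) → T (U x y)
  Gᵃ⊆U x y = pointwise (edge H x y) (adj G x y) (A x y) (D x y) edge-H⇒adj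
    where
    pointwise : ∀ h g a d → (T h → T g) → T ((h ∧ not d) ∨ a) → T (g ∨ (a ∨ d))
    pointwise _     true  _     _ _   _ = tt
    pointwise _     false true  _ _   _ = tt
    pointwise true  false false _ h⇒g _ = ⊥-elim (h⇒g tt)
    pointwise false false false _ _   ()

  Gᵇ⊆U : ∀ x y → T (edge Gᵇ x y) → T (U x y)
  Gᵇ⊆U x y = pointwise (edge H x y) (adj G x y) (A x y) (D x y) edge-H⇒adj
    where
    pointwise : ∀ h g a d → (T h → T g) → T ((h ∧ not a) ∨ d) → T (g ∨ (a ∨ d))
    pointwise _     true  _     _     _   _ = tt
    pointwise _     false true  _     _   _ = tt
    pointwise _     false false true  _   _ = tt
    pointwise true  false false false h⇒g _ = ⊥-elim (h⇒g tt)
    pointwise false false false false _   ()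

  Gᵃ≡G′-where-H≡G : ∀ {x y} → edge H x y ≡ adj G x y → edge Gᵃ x y ≡ edge G′ x y
  Gᵃ≡G′-where-H≡G {x} {y} H≡G =
    trans (cong (λ h → (h ∧ not (D x y)) ∨ A x y) H≡G) (pointwise (adj G x y) (A x y) (D x y) A⇒¬adj D⇒adj)
    where
    pointwise : ∀ g a d → (T a → ¬ T g) → (T d → T g) → (g ∧ not d) ∨ a ≡ (g ∨ a) ∧ not d
    pointwise true  true  _     a⇒¬g _   = ⊥-elim (a⇒¬g tt tt)
    pointwise true  false true  _    _   = refl
    pointwise true  false false _    _   = refl
    pointwise false true  true  _    d⇒g = ⊥-elim (d⇒g tt)
    pointwise false true  false _    _   = refl
    pointwise false false _     _    _   = refl

  Gᵇ≡G-where-H≡G : ∀ {x y} → edge H x y ≡ adj G x y → edge Gᵇ x y ≡ edge G₀ x y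
  Gᵇ≡G-where-H≡G {x} {y} H≡G =
    trans (cong (λ h → (h ∧ not (A x y)) ∨ D x y) H≡G) (pointwise (adj G x y) (A x y) (D x y) A⇒¬adj D⇒adj)
    where
    pointwise : ∀ g a d → (T a → ¬ T g) → (T d → T g) → (g ∧ not a) ∨ d ≡ g
    pointwise true  true  _     a⇒¬g _   = ⊥-elim (a⇒¬g tt tt)
    pointwise true  false _     _    _   = refl
    pointwise false _     true  _    d⇒g = ⊥-elim (d⇒g tt)
    pointwise false _     false _    _   = refl

  G′≡G-off-batch : ∀ {x y} → ¬ T (B x y) → edge G′ x y ≡ edge G₀ x y
  G′≡G-off-batch {x} {y} = pointwise (adj G x y) (A x y) (D x y)
    where
    pointwise : ∀ g a d → ¬ T (a ∨ d) → (g ∨ a) ∧ not d ≡ g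
    pointwise _     true  _     ¬a∨d = ⊥-elim (¬a∨d tt)
    pointwise _     false true  ¬a∨d = ⊥-elim (¬a∨d tt)
    pointwise true  false false _    = refl
    pointwise false false false _    = refl

  Gᵃ≡Gᵇ-off-batch : ∀ {x y} → ¬ T (B x y) → edge Gᵃ x y ≡ edge Gᵇ x y
  Gᵃ≡Gᵇ-off-batch {x} {y} = pointwise (edge H x y) (A x y) (D x y)
    where
    pointwise : ∀ h a d → ¬ T (a ∨ d) → (h ∧ not d) ∨ a ≡ (h ∧ not a) ∨ d
    pointwise _ true  _     ¬a∨d = ⊥-elim (¬a∨d tt)
    pointwise _ false true  ¬a∨d = ⊥-elim (¬a∨d tt)
    pointwise _ false false _    = refl

  module _ (q : Quad n) where

    private
      Q : Fin 4 → Fin n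
      Q = quadAt q

    Touched : Set
    Touched = ∃₂ λ p r → T (B (Q p) (Q r))

    touched? : Dec Touched
    touched? = any? λ p → any? λ r → T? (B (Q p) (Q r))

    Covered : Set
    Covered = (∀ i → T (vert H (Q i))) × (∀ i j → edge H (Q i) (Q j) ≡ adj G (Q i) (Q j))

    touched-connected⇒covered : Touched → Connected₄ (induced U q) → Covered
    touched-connected⇒covered (p , r , pr) conn = vert-covered , edge-covered
      where
      distinct : ∀ {i j} → T (adj G (Q i) (Q j)) → ¬ Incident (Q i) → ¬ Incident (Q j) → Distinct i j p r
      distinct ij ¬i ¬j =
        (λ { refl → adj-irrefl _ ij }) , (λ { refl → ¬i (_ , pr) }) , (λ { refl → ¬i (_ , B-sym pr) }) ,
        (λ { refl → ¬j (_ , pr) }) , (λ { refl → ¬j (_ , B-sym pr) }) , (λ { refl → B-irrefl _ pr })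

      -- If neither endpoint touches the batch, connectivity across the split
      -- {i, j} | {p, r} gives a G-edge from i or j to p or r, so i and j are
      -- both within distance 2 of p or of r.
      adj⇒inSameSₑ : ∀ i j → T (adj G (Q i) (Q j)) → InSameSₑ (Q i) (Q j)
      adj⇒inSameSₑ i j ij with incident? (Q i) | incident? (Q j)
      ... | yes (_ , b) | _ = inSameSₑ-at-batch b ij
      ... | no _ | yes (_ , b) = inSameSₑ-sym (inSameSₑ-at-batch b (adj-sym ij))
      ... | no ¬i | no ¬j with across conn i j p r (distinct ij ¬i ¬j)
      ... | inj₁ ip = inSameSₑ-near-batch pr (adj-sym (¬incident-U⇒adj ¬i ip)) ij
      ... | inj₂ (inj₁ ir) = inSameSₑ-near-batch (B-sym pr) (adj-sym (¬incident-U⇒adj ¬i ir)) ij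
      ... | inj₂ (inj₂ (inj₁ jp)) =
        inSameSₑ-sym (inSameSₑ-near-batch pr (adj-sym (¬incident-U⇒adj ¬j jp)) (adj-sym ij))
      ... | inj₂ (inj₂ (inj₂ jr)) =
        inSameSₑ-sym (inSameSₑ-near-batch (B-sym pr) (adj-sym (¬incident-U⇒adj ¬j jr)) (adj-sym ij))

      vert-covered : ∀ i → T (vert H (Q i))
      vert-covered i with incident? (Q i)
      ... | yes (_ , b) = B⇒vert-H b
      ... | no ¬i = let j , ij = neighbour conn i in inSameSₑ⇒vert-H (adj⇒inSameSₑ i j (¬incident-U⇒adj ¬i ij))

      edge-covered : ∀ i j → edge H (Q i) (Q j) ≡ adj G (Q i) (Q j)
      edge-covered i j = T-⇔⇒≡ edge-H⇒adj (λ ij → inSameSₑ⇒edge-H (adj⇒inSameSₑ i j ij) ij)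

    occurs-touched : ∀ {X Y} t → (∀ x y → T (edge X x y) → T (U x y)) → (∀ x y → T (edge Y x y) → T (U x y)) →
      (Covered → occurs X t q ≡ occurs Y t q) → Touched → occurs X t q ≡ occurs Y t q
    occurs-touched {X} {Y} t X⊆U Y⊆U agree touch = ≡-from-either-true
      (touched-connected⇒covered touch ∘ connected₄-mono (λ i j → X⊆U _ _) ∘ occurs-connected X t q)
      (touched-connected⇒covered touch ∘ connected₄-mono (λ i j → Y⊆U _ _) ∘ occurs-connected Y t q) agree

    inVerts-covered : ∀ X → (∀ x → T (vert H x) → T (vert X x)) → Covered → inVerts X q ≡ true
    inVerts-covered X H⊆X (vert-covered , _) =
      T-≡ {inVerts X q} .to (allFinᵇ⁺ {f = λ i → vert X (Q i)} λ i → H⊆X (Q i) (vert-covered i))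

    occurs-Gᵃ-touched : ∀ t → Touched → occurs Gᵃ t q ≡ occurs G′ t q
    occurs-Gᵃ-touched t = occurs-touched {Gᵃ} {G′} t Gᵃ⊆U G′⊆U λ cov →
      cong₂ _∧_ (inVerts-covered Gᵃ (λ x → T-∨ {vert H x} .from ∘ inj₁) cov)
        (isoᵇ-cong Gᵃ G′ q (graphlet t) λ i j → Gᵃ≡G′-where-H≡G (proj₂ cov i j))

    occurs-Gᵇ-touched : ∀ t → Touched → occurs Gᵇ t q ≡ occurs G₀ t q
    occurs-Gᵇ-touched t = occurs-touched {Gᵇ} {G₀} t Gᵇ⊆U G₀⊆U λ cov →
      cong₂ _∧_ (inVerts-covered Gᵇ (λ x → T-∨ {vert H x} .from ∘ inj₁) cov)
        (isoᵇ-cong Gᵇ G₀ q (graphlet t) λ i j → Gᵇ≡G-where-H≡G (proj₂ cov i j))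

    occurs-G′-untouched : ∀ t → ¬ Touched → occurs G′ t q ≡ occurs G₀ t q
    occurs-G′-untouched t ¬touch =
      isoᵇ-cong G′ G₀ q (graphlet t) λ i j → G′≡G-off-batch (λ b → ¬touch (i , j , b))

    occurs-Gᵃ-untouched : ∀ t → ¬ Touched → occurs Gᵃ t q ≡ occurs Gᵇ t q
    occurs-Gᵃ-untouched t ¬touch = cong₂ _∧_
      (allFinᵇ-cong λ i → trans (vert-Gᵃ (Q i)) (sym (vert-Gᵇ (Q i))))
      (isoᵇ-cong Gᵃ Gᵇ q (graphlet t) λ i j → Gᵃ≡Gᵇ-off-batch (λ b → ¬touch (i , j , b)))

    occurs-samePair : ∀ t → SamePair (occurs G′ t q) (occurs Gᵇ t q) (occurs G₀ t q) (occurs Gᵃ t q)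
    occurs-samePair t = by-cases touched?
      where
      by-cases : Dec Touched → SamePair (occurs G′ t q) (occurs Gᵇ t q) (occurs G₀ t q) (occurs Gᵃ t q)
      by-cases (yes touch) = inj₂ (sym (occurs-Gᵃ-touched t touch) , occurs-Gᵇ-touched t touch)
      by-cases (no ¬touch) = inj₁ (occurs-G′-untouched t ¬touch , sym (occurs-Gᵃ-untouched t ¬touch))

lemma2 : (n : ℕ) (G : Graph n) (A D : Fin n → Fin n → Bool) →
    (∀ x y → A x y ≡ A y x) → (∀ x y → D x y ≡ D y x) →
    (∀ x y → A x y ≡ true → x ≢ y × adj G x y ≡ false) →
    (∀ x y → D x y ≡ true → adj G x y ≡ true) →
    (t : Fin 6) →
    + freq (updated G A D) t ≡ (+ freq (toSGraph G) t + + freq (Ga G A D) t) - + freq (Gb G A D) t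
lemma2 n G A D A-sym D-sym A-new D-old t =
  pos-≡-difference (freq G′ t) (freq G₀ t) (freq Gᵃ t) (freq Gᵇ t)
    (length-filterᵇ-samePair (λ q → occurs-samePair q t) (allQuads n))
  where open BatchUpdate G A D A-sym D-sym A-new D-old
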